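{- Let $\mathcal{S}$ be a finite commutative semigroup which is group-free, i.e. all subgroups of $\mathcal{S}$ are trivial (equivalently $\exp(\mathcal{S})=1$). Then $$\mathsf E(\mathcal{S})\leq \mathsf D(\mathcal{S})+\kappa(\mathcal{S})-1 .$$
   Context: Semigroups are written additively. A sequence over $\mathcal{S}$ is a finite unordered sequence of elements of $\mathcal{S}$ with repetition allowed (an element of the free commutative monoid on $\mathcal{S}$); $|A|$ is its length, $B\mid A$ means $B$ is a subsequence of $A$, and $\sigma(A)$ is the sum of all terms of $A$. The empty sequence is allowed as a subsequence only when $\mathcal{S}$ has an identity element $0_{\mathcal{S}}$, and then $\sigma(\text{empty})=0_{\mathcal{S}}$. A sequence $A$ is reducible if $\sigma(B)=\sigma(A)$ for some proper subsequence $B$ of $A$ ($B\mid A$, $B\neq A$). The Davenport constant $\mathsf D(\mathcal{S})$ is the smallest $\ell$ such that every sequence over $\mathcal{S}$ of length $\ge \ell$ is reducible. The period of $a\in\mathcal{S}$ is the least $t\ge1$ such that $ra=(r+t)a$ for some integer $r>0$; $\exp(\mathcal{S})$ is the least common multiple of the periods of all elements. Put $\kappa(\mathcal{S})=\lceil |\mathcal{S}|/\exp(\mathcal{S})\rceil\exp(\mathcal{S})$. $\mathsf E(\mathcal{S})$ is the smallest positive integer $\ell$ such that every sequence $A$ over $\mathcal{S}$ of length $\ell$ contains a subsequence $B$ with $\sigma(B)=\sigma(A)$ and $|A|-|B|=\kappa(\mathcal{S})$. -}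

module Defs where

open import Data.Nat using (ℕ; zero; suc; _+_; _*_; _∸_; _≤_; _<_; NonZero)
open import Data.Nat.DivMod using (_/_)
open import Data.Nat.Divisibility using (_∣_)
open import Data.Fin using (Fin)
open import Data.List using (List; []; _∷_; length; foldr)
open import Data.List.Relation.Binary.Sublist.Propositional using (_⊆_)
open import Data.Product using (Σ; ∃; _×_; _,_)
open import Relation.Binary.PropositionalEquality using (_≡_)

-- ⌈ n / e ⌉ * e  for e ≠ 0
kappaOf : (n e : ℕ) → .{{NonZero e}} → ℕ
kappaOf n e = ((n + e ∸ 1) / e) * e

record FinCommSemigroup : Set where
  field
    n      : ℕ
    nonempty : 1 ≤ n
    _∙_    : Fin n → Fin n → Fin n
    assoc  : ∀ x y z → (x ∙ y) ∙ z ≡ x ∙ (y ∙ z)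
    comm   : ∀ x y → x ∙ y ≡ y ∙ x

module _ (S : FinCommSemigroup) where
  open FinCommSemigroup S

  Elem : Set
  Elem = Fin n

  -- Sequences over S are lists (order irrelevant since ∙ is commutative);
  -- subsequences are sublists (every sub-multiset is realised by a sublist).
  Seq : Set
  Seq = List Elem

  IsIdentity : Elem → Set
  IsIdentity e = ∀ x → e ∙ x ≡ x

  -- SumIs A s : σ(A) = s.  For the empty sequence, σ(empty) is the identity
  -- (so this is only satisfiable when S has an identity).
  SumIs : Seq → Elem → Set
  SumIs []       s = IsIdentity s
  SumIs (x ∷ xs) s = foldr _∙_ x xs ≡ s

  Reducible : Seq → Set
  Reducible A = ∃ λ s → SumIs A s ×
                Σ Seq (λ B → B ⊆ A × length B < length A × SumIs B s)

  IsDavenport : ℕ → Set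
  IsDavenport d =
    (∀ (A : Seq) → d ≤ length A → Reducible A) ×
    (∀ (ℓ : ℕ) → (∀ (A : Seq) → ℓ ≤ length A → Reducible A) → d ≤ ℓ)

  -- positive multiples: mult k a = (k+1) a
  mult : ℕ → Elem → Elem
  mult zero    a = a
  mult (suc k) a = a ∙ mult k a

  _·_ : ℕ → Elem → Elem
  zero  · a = a   -- unused (r > 0 always required)
  suc r · a = mult r a

  PeriodWitness : Elem → ℕ → Set
  PeriodWitness a t = 1 ≤ t × ∃ λ r → 1 ≤ r × (r · a ≡ (r + t) · a)

  IsPeriod : Elem → ℕ → Set
  IsPeriod a t = PeriodWitness a t × (∀ t' → PeriodWitness a t' → t ≤ t')

  IsExp : ℕ → Set
  IsExp e = (∀ a t → IsPeriod a t → t ∣ e) ×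
            (∀ e' → (∀ a t → IsPeriod a t → t ∣ e') → e ∣ e')

  EProperty : ℕ → ℕ → Set
  EProperty κ ℓ = ∀ (A : Seq) → length A ≡ ℓ →
    ∃ λ s → SumIs A s ×
      Σ Seq (λ B → B ⊆ A × length A ≡ length B + κ × SumIs B s)

-- In a group-free semigroup every element a has a multiple k·a with (k+1)·a = k·a.  From this,
-- x + c₁ + c₂ = x implies x + c₁ = x: add k·(c₁ + c₂) to x, which leaves it unchanged, and then c₁
-- is swallowed by k·c₁.  Hence if a subsequence B of A has the same sum as A, so has every
-- sequence between B and A.  A sequence of length at least D(S) is reducible, so one may delete
-- one term at a time without changing the sum, as long as the length stays at least D(S) - 1;
-- from length D(S) + κ(S) - 1 this deletes κ(S) terms.
module Submission where

open import Defs
open import Data.Nat using (ℕ; zero; suc; _+_; _∸_; _≤_; _<_; s≤s; z≤n)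
open import Data.Nat.Properties
  using (≮⇒≥; n<1+n; +-suc; +-comm; m≤n⇒∃[o]m+o≡n; m≤m+n; m≤n+m; m≤n+m∸n; +-∸-assoc; *-identityʳ;
         m+n∸n≡m; +-identityʳ; ≤-trans; ≤-refl)
open import Data.Nat.DivMod using (n/1≡n)
open import Data.Nat.Divisibility using (∣1⇒≡1)
open import Data.Nat.Induction using (<-rec)
open import Data.Fin using (Fin; toℕ)
open import Data.Fin.Properties using (pigeonhole) renaming (_≟_ to _≟ᶠ_)
open import Data.List using (List; []; _∷_; length; foldr)
open import Data.List.Relation.Binary.Sublist.Propositional using (_⊆_; []; _∷_; _∷ʳ_; ⊆-refl; ⊆-trans)
open import Data.Maybe using (Maybe; just; nothing)
open import Data.Maybe.Properties using (just-injective)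
open import Data.Product using (Σ; ∃; _×_; _,_; proj₁; proj₂)
open import Function.Bundles using (_⇔_; mk⇔; Equivalence)
open import Level using (0ℓ)
open import Algebra.Bundles using (CommutativeSemigroup)
open import Relation.Binary.PropositionalEquality.Algebra using (isMagma)
import Algebra.Properties.CommutativeSemigroup as CommSemigroupProperties
open import Relation.Nullary using (¬_)
open import Relation.Nullary.Negation using (¬¬-map)
open import Relation.Nullary.Decidable using (decidable-stable)
open import Relation.Binary.PropositionalEquality
  using (_≡_; refl; sym; trans; cong; subst; module ≡-Reasoning)

¬¬-least : (P : ℕ → Set) {m : ℕ} → P m → ¬ ¬ (∃ λ t → P t × (∀ t′ → P t′ → t ≤ t′))
¬¬-least P {m} pm noLeast = <-rec (λ m → ¬ P m) noneBelow m pm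
  where
  noneBelow : ∀ m → (∀ {m′} → m′ < m → ¬ P m′) → ¬ P m
  noneBelow m below pm = noLeast (m , pm , λ t′ pt′ → ≮⇒≥ (λ t′<m → below t′<m pt′))

kappaOf-exp1 : ∀ m → kappaOf m 1 ≡ m
kappaOf-exp1 m = trans (*-identityʳ _) (trans (n/1≡n (m + 1 ∸ 1)) (m+n∸n≡m m 1))

⊆-strict-step : ∀ {X : Set} {B A : List X} → B ⊆ A → length B < length A →
                ∃ λ A′ → B ⊆ A′ × A′ ⊆ A × length A ≡ suc (length A′)
⊆-strict-step (y ∷ʳ B⊆A) _ = _ , B⊆A , y ∷ʳ ⊆-refl , refl
⊆-strict-step (x≡y ∷ B⊆A) (s≤s |B|<|A|) with ⊆-strict-step B⊆A |B|<|A|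
... | A′ , B⊆A′ , A′⊆A , |A|≡1+|A′| = _ ∷ A′ , x≡y ∷ B⊆A′ , refl ∷ A′⊆A , cong suc |A|≡1+|A′|

module _ (S : FinCommSemigroup) where
  open FinCommSemigroup S
  open ≡-Reasoning

  commutativeSemigroup : CommutativeSemigroup 0ℓ 0ℓ
  commutativeSemigroup = record
    { isCommutativeSemigroup = record
      { isSemigroup = record { isMagma = isMagma _∙_ ; assoc = assoc }
      ; comm        = comm
      }
    }

  open CommSemigroupProperties commutativeSemigroup using (interchange; x∙yz≈y∙xz; xy∙z≈zx∙y)

  periodWitness : ∀ a → ∃ (PeriodWitness S a)
  periodWitness a with pigeonhole (n<1+n n) (λ (i : Fin (suc n)) → mult S (toℕ i) a)
  ... | i , j , i<j , i·a≡j·a with m≤n⇒∃[o]m+o≡n i<j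
  ... | u , i+1+u≡j =
    suc u , s≤s z≤n , suc (toℕ i) , s≤s z≤n ,
    trans i·a≡j·a (cong (λ k → mult S k a) (trans (sym i+1+u≡j) (sym (+-suc (toℕ i) u))))

  Stabilises : Elem S → Set
  Stabilises a = ∃ λ k → mult S (suc k) a ≡ mult S k a

  period1⇒stabilises : ∀ {a} → PeriodWitness S a 1 → Stabilises a
  period1⇒stabilises {a} (_ , suc r , _ , r·a≡[r+1]·a) =
    r , sym (trans r·a≡[r+1]·a (cong (λ k → mult S k a) (+-comm r 1)))

  groupFree⇒¬¬stabilises : IsExp S 1 → ∀ a → ¬ ¬ Stabilises a
  groupFree⇒¬¬stabilises groupFree a =
    ¬¬-map period⇒stabilises (¬¬-least (PeriodWitness S a) (proj₂ (periodWitness a)))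
    where
    period⇒stabilises : (∃ λ t → IsPeriod S a t) → Stabilises a
    period⇒stabilises (t , isPeriod) with ∣1⇒≡1 (proj₁ groupFree a t isPeriod)
    ... | refl = period1⇒stabilises (proj₁ isPeriod)

  mult-∙ : ∀ k u v → mult S k (u ∙ v) ≡ mult S k u ∙ mult S k v
  mult-∙ zero    u v = refl
  mult-∙ (suc k) u v = trans (cong ((u ∙ v) ∙_) (mult-∙ k u v)) (interchange u v (mult S k u) (mult S k v))

  absorbs-mult : ∀ {x c} → x ∙ c ≡ x → ∀ k → x ∙ mult S k c ≡ x
  absorbs-mult x∙c≡x zero    = x∙c≡x
  absorbs-mult {x} {c} x∙c≡x (suc k) = begin
    x ∙ (c ∙ mult S k c) ≡⟨ sym (assoc x c (mult S k c)) ⟩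
    (x ∙ c) ∙ mult S k c ≡⟨ cong (_∙ mult S k c) x∙c≡x ⟩
    x ∙ mult S k c       ≡⟨ absorbs-mult x∙c≡x k ⟩
    x                    ∎

  absorbs-factor : ∀ {x c₁ c₂} → Stabilises c₁ → x ∙ (c₁ ∙ c₂) ≡ x → x ∙ c₁ ≡ x
  absorbs-factor {x} {c₁} {c₂} (k , [k+1]c₁≡kc₁) x∙c₁c₂≡x = begin
    x ∙ c₁                  ≡⟨ cong (_∙ c₁) (sym x≡x∙m₁m₂) ⟩
    (x ∙ (m₁ ∙ m₂)) ∙ c₁    ≡⟨ assoc x (m₁ ∙ m₂) c₁ ⟩
    x ∙ ((m₁ ∙ m₂) ∙ c₁)    ≡⟨ cong (x ∙_) (xy∙z≈zx∙y m₁ m₂ c₁) ⟩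
    x ∙ ((c₁ ∙ m₁) ∙ m₂)    ≡⟨ cong (λ y → x ∙ (y ∙ m₂)) [k+1]c₁≡kc₁ ⟩
    x ∙ (m₁ ∙ m₂)           ≡⟨ x≡x∙m₁m₂ ⟩
    x                       ∎
    where
    m₁ m₂ : Elem S
    m₁ = mult S k c₁
    m₂ = mult S k c₂
    x≡x∙m₁m₂ : x ∙ (m₁ ∙ m₂) ≡ x
    x≡x∙m₁m₂ = trans (cong (x ∙_) (sym (mult-∙ k c₁ c₂))) (absorbs-mult x∙c₁c₂≡x k)

  S¹ : Set
  S¹ = Maybe (Elem S)

  _⊕_ : S¹ → S¹ → S¹
  nothing ⊕ Y       = Y
  just x  ⊕ nothing = just x
  just x  ⊕ just y  = just (x ∙ y)

  ⊕-identityʳ : ∀ X → X ⊕ nothing ≡ X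
  ⊕-identityʳ nothing  = refl
  ⊕-identityʳ (just x) = refl

  ⊕-assoc : ∀ X Y Z → (X ⊕ Y) ⊕ Z ≡ X ⊕ (Y ⊕ Z)
  ⊕-assoc nothing  Y        Z        = refl
  ⊕-assoc (just x) nothing  Z        = refl
  ⊕-assoc (just x) (just y) nothing  = refl
  ⊕-assoc (just x) (just y) (just z) = cong just (assoc x y z)

  ⊕-comm : ∀ X Y → X ⊕ Y ≡ Y ⊕ X
  ⊕-comm nothing  Y        = sym (⊕-identityʳ Y)
  ⊕-comm (just x) nothing  = refl
  ⊕-comm (just x) (just y) = cong just (comm x y)

  commutativeSemigroup¹ : CommutativeSemigroup 0ℓ 0ℓ
  commutativeSemigroup¹ = record
    { isCommutativeSemigroup = record
      { isSemigroup = record { isMagma = isMagma _⊕_ ; assoc = ⊕-assoc }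
      ; comm        = ⊕-comm
      }
    }

  open CommSemigroupProperties commutativeSemigroup¹ using () renaming (x∙yz≈y∙xz to X⊕YZ≡Y⊕XZ)

  -- nothing stands for the adjoined identity, which an identity of S (if any) also represents
  Represents : S¹ → Elem S → Set
  Represents nothing  s = IsIdentity S s
  Represents (just x) s = x ≡ s

  Represents-⊕ : ∀ {s} X Z → Represents X s → Represents (X ⊕ Z) s ⇔ (just s ⊕ Z ≡ just s)
  Represents-⊕ (just x) nothing  refl = mk⇔ (λ _ → refl) (λ _ → refl)
  Represents-⊕ (just x) (just z) refl = mk⇔ (cong just) just-injective
  Represents-⊕ nothing  nothing  id-s = mk⇔ (λ _ → refl) (λ _ → id-s)
  Represents-⊕ {s} nothing (just z) id-s = mk⇔ to from
    where
    to : z ≡ s → just (s ∙ z) ≡ just s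
    to refl = cong just (id-s s)
    from : just (s ∙ z) ≡ just s → z ≡ s
    from s∙z≡s = trans (sym (id-s z)) (just-injective s∙z≡s)

  -- Defined so that Represents (σ A) s unfolds to SumIs S A s in both cases.
  σ : Seq S → S¹
  σ []       = nothing
  σ (x ∷ xs) = just (foldr _∙_ x xs)

  SumIs⇔Represents-σ : ∀ {s} A → SumIs S A s ⇔ Represents (σ A) s
  SumIs⇔Represents-σ []      = mk⇔ (λ h → h) (λ h → h)
  SumIs⇔Represents-σ (_ ∷ _) = mk⇔ (λ h → h) (λ h → h)

  foldr-swap-seed : ∀ x y xs → x ∙ foldr _∙_ y xs ≡ y ∙ foldr _∙_ x xs
  foldr-swap-seed x y []       = comm x y
  foldr-swap-seed x y (z ∷ zs) = begin
    x ∙ (z ∙ foldr _∙_ y zs) ≡⟨ x∙yz≈y∙xz x z _ ⟩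
    z ∙ (x ∙ foldr _∙_ y zs) ≡⟨ cong (z ∙_) (foldr-swap-seed x y zs) ⟩
    z ∙ (y ∙ foldr _∙_ x zs) ≡⟨ x∙yz≈y∙xz z y _ ⟩
    y ∙ (z ∙ foldr _∙_ x zs) ∎

  σ-∷ : ∀ y A → σ (y ∷ A) ≡ just y ⊕ σ A
  σ-∷ y []       = refl
  σ-∷ y (x ∷ xs) = cong just (foldr-swap-seed x y xs)

  σ-⊆ : ∀ {B A} → B ⊆ A → ∃ λ C → σ A ≡ σ B ⊕ C
  σ-⊆ [] = nothing , refl
  σ-⊆ {B} {y ∷ A} (.y ∷ʳ B⊆A) with σ-⊆ B⊆A
  ... | C , σA≡σB⊕C = just y ⊕ C , (begin
    σ (y ∷ A)          ≡⟨ σ-∷ y A ⟩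
    just y ⊕ σ A       ≡⟨ cong (just y ⊕_) σA≡σB⊕C ⟩
    just y ⊕ (σ B ⊕ C) ≡⟨ X⊕YZ≡Y⊕XZ (just y) (σ B) C ⟩
    σ B ⊕ (just y ⊕ C) ∎)
  σ-⊆ {x ∷ B} {.x ∷ A} (refl ∷ B⊆A) with σ-⊆ B⊆A
  ... | C , σA≡σB⊕C = C , (begin
    σ (x ∷ A)          ≡⟨ σ-∷ x A ⟩
    just x ⊕ σ A       ≡⟨ cong (just x ⊕_) σA≡σB⊕C ⟩
    just x ⊕ (σ B ⊕ C) ≡⟨ sym (⊕-assoc (just x) (σ B) C) ⟩
    (just x ⊕ σ B) ⊕ C ≡⟨ cong (_⊕ C) (sym (σ-∷ x B)) ⟩
    σ (x ∷ B) ⊕ C      ∎)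

  SumIs-unique : ∀ {A s s′} → SumIs S A s → SumIs S A s′ → s ≡ s′
  SumIs-unique {[]}    {s} {s′} id-s id-s′ = trans (sym (id-s′ s)) (trans (comm s′ s) (id-s s′))
  SumIs-unique {_ ∷ _} refl refl = refl

  1≤reducibility-threshold : ∀ {d} → (∀ A → d ≤ length A → Reducible S A) → 1 ≤ d
  1≤reducibility-threshold {zero} long⇒reducible with long⇒reducible [] z≤n
  ... | _ , _ , _ , _ , () , _
  1≤reducibility-threshold {suc _} _ = s≤s z≤n

  module GroupFree (groupFree : IsExp S 1) where

    absorbs-factor¹ : ∀ x C₁ C₂ → just x ⊕ (C₁ ⊕ C₂) ≡ just x → just x ⊕ C₁ ≡ just x
    absorbs-factor¹ x nothing   _         _   = refl
    absorbs-factor¹ x (just c₁) nothing   eq  = eq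
    -- Stabilisation is only known up to double negation; equality in Fin n is decidable.
    absorbs-factor¹ x (just c₁) (just c₂) eq  =
      cong just (decidable-stable (x ∙ c₁ ≟ᶠ x)
        (¬¬-map (λ st → absorbs-factor st (just-injective eq)) (groupFree⇒¬¬stabilises groupFree c₁)))

    SumIs-between : ∀ {B A′ A s} → B ⊆ A′ → A′ ⊆ A → SumIs S B s → SumIs S A s → SumIs S A′ s
    SumIs-between {B} {A′} {A} {s} B⊆A′ A′⊆A sumB sumA with σ-⊆ B⊆A′ | σ-⊆ A′⊆A
    ... | C₁ , σA′≡σB⊕C₁ | C₂ , σA≡σA′⊕C₂ =
      Equivalence.from (SumIs⇔Represents-σ A′)
        (subst (λ X → Represents X s) (sym σA′≡σB⊕C₁) (Equivalence.from (Represents-⊕ (σ B) C₁ repB) s⊕C₁≡s))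
      where
      repB : Represents (σ B) s
      repB = Equivalence.to (SumIs⇔Represents-σ B) sumB
      σA≡σB⊕C₁C₂ : σ A ≡ σ B ⊕ (C₁ ⊕ C₂)
      σA≡σB⊕C₁C₂ = begin
        σ A               ≡⟨ σA≡σA′⊕C₂ ⟩
        σ A′ ⊕ C₂         ≡⟨ cong (_⊕ C₂) σA′≡σB⊕C₁ ⟩
        (σ B ⊕ C₁) ⊕ C₂   ≡⟨ ⊕-assoc (σ B) C₁ C₂ ⟩
        σ B ⊕ (C₁ ⊕ C₂)   ∎
      s⊕C₁≡s : just s ⊕ C₁ ≡ just s
      s⊕C₁≡s = absorbs-factor¹ s C₁ C₂ (Equivalence.to (Represents-⊕ (σ B) (C₁ ⊕ C₂) repB)
        (subst (λ X → Represents X s) σA≡σB⊕C₁C₂ (Equivalence.to (SumIs⇔Represents-σ A) sumA)))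

    module _ {d : ℕ} (long⇒reducible : ∀ A → d ≤ length A → Reducible S A) where

      delete-one : ∀ {A s} → d ≤ length A → SumIs S A s →
                   ∃ λ A′ → A′ ⊆ A × length A ≡ suc (length A′) × SumIs S A′ s
      delete-one {A} d≤|A| sumA with long⇒reducible A d≤|A|
      ... | _ , sum′A , B , B⊆A , |B|<|A| , sum′B with ⊆-strict-step B⊆A |B|<|A|
      ... | A′ , B⊆A′ , A′⊆A , |A|≡1+|A′| =
        A′ , A′⊆A , |A|≡1+|A′| , SumIs-between B⊆A′ A′⊆A (subst (SumIs S B) (SumIs-unique sum′A sumA) sum′B) sumA

      delete : ∀ k {A s} → k + d ≤ suc (length A) → SumIs S A s →
               Σ (Seq S) λ B → B ⊆ A × length A ≡ length B + k × SumIs S B s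
      delete zero    {A} _ sumA = A , ⊆-refl , sym (+-identityʳ (length A)) , sumA
      delete (suc k) {A} (s≤s k+d≤|A|) sumA with delete-one (≤-trans (m≤n+m d k) k+d≤|A|) sumA
      ... | A′ , A′⊆A , |A|≡1+|A′| , sumA′
        with delete k (subst (λ m → k + d ≤ m) |A|≡1+|A′| k+d≤|A|) sumA′
      ... | B , B⊆A′ , |A′|≡|B|+k , sumB =
        B , ⊆-trans B⊆A′ A′⊆A , trans |A|≡1+|A′| (trans (cong suc |A′|≡|B|+k) (sym (+-suc (length B) k))) , sumB

mainTheorem1 : (S : FinCommSemigroup) → IsExp S 1 →
    (d : ℕ) → IsDavenport S d →
    ∃ λ ℓ → 1 ≤ ℓ × ℓ ≤ d + kappaOf (FinCommSemigroup.n S) 1 ∸ 1 ×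
      EProperty S (kappaOf (FinCommSemigroup.n S) 1) ℓ
mainTheorem1 S groupFree d (long⇒reducible , _) =
  d + κ ∸ 1 , ≤-trans (1≤reducibility-threshold S long⇒reducible) d≤ℓ , ≤-refl , EProperty-ℓ
  where
  open GroupFree S groupFree
  κ : ℕ
  κ = kappaOf (FinCommSemigroup.n S) 1
  1≤κ : 1 ≤ κ
  1≤κ = subst (1 ≤_) (sym (kappaOf-exp1 _)) (FinCommSemigroup.nonempty S)
  d≤ℓ : d ≤ d + κ ∸ 1
  d≤ℓ = subst (d ≤_) (sym (+-∸-assoc d 1≤κ)) (m≤m+n d (κ ∸ 1))
  κ+d≤1+ℓ : κ + d ≤ suc (d + κ ∸ 1)
  κ+d≤1+ℓ = subst (_≤ suc (d + κ ∸ 1)) (+-comm d κ) (m≤n+m∸n (d + κ) 1)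
  EProperty-ℓ : EProperty S κ (d + κ ∸ 1)
  EProperty-ℓ A |A|≡ℓ with long⇒reducible A (subst (d ≤_) (sym |A|≡ℓ) d≤ℓ)
  ... | s , sumA , _ =
    s , sumA , delete long⇒reducible κ (subst (λ m → κ + d ≤ suc m) (sym |A|≡ℓ) κ+d≤1+ℓ) sumA
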